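{- Let $w,w'$ be binary words. (1) If $w'$ has more than two runs, then $[\sigma(w)]$ contains $[\sigma(w')]$ if and only if $w'$ is a subsequence of $w$. (2) If $w' = 0^{a+1}1^b$ for some $a,b \geq 0$, then $[\sigma(w)]$ contains $[\sigma(w')]$ if and only if $w$ contains $0^{a+1}1^b$ or $1^{b+1}0^a$ as a subsequence. (3) If $w' = 1^{b+1}0^a$ for some $a,b \geq 0$, then $[\sigma(w)]$ contains $[\sigma(w')]$ if and only if $w$ contains $0^{a+1}1^b$ or $1^{b+1}0^a$ as a subsequence.
   Context: A binary word is a finite sequence over $\{0,1\}$; a run is a maximal block of consecutive equal letters; subsequences need not be contiguous. For a binary word $w=w_1\cdots w_{n-1}$, $\sigma(w)=\sigma_1\cdots\sigma_n$ is the permutation of $[n]$ where, for $k=1,\dots,n-1$, $\sigma_k$ is the minimum of the unused values of $[n]$ if $w_k=0$ and the maximum if $w_k=1$, and $\sigma_n$ is the remaining value. A circular permutation $[\pi]$ is the set of all rotations of $\pi$; $[\sigma]$ contains $[\pi]$ if some rotation of $\sigma$ has a subsequence order-isomorphic to $\pi$. -}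

module Defs where

open import Data.Bool using (Bool; true; false; if_then_else_)
open import Data.Bool.Properties using () renaming (_≟_ to _≟ᵇ_)
open import Data.Nat using (ℕ; zero; suc; _+_; _∸_; _<_)
open import Data.List using (List; []; _∷_; _++_; length; drop; take; replicate; lookup)
open import Data.List.Relation.Binary.Sublist.Propositional using (_⊆_)
open import Data.Fin using (Fin; cast)
open import Data.Product using (Σ; ∃; _×_)
open import Relation.Binary.PropositionalEquality using (_≡_)
open import Relation.Nullary using (does)
open import Function.Bundles using (_⇔_)

-- Binary words: false = letter 0, true = letter 1.
Word : Set
Word = List Bool

-- σ-construction. The unused values always form an interval [lo, hi];
-- letter 0 takes the minimum lo, letter 1 takes the maximum hi,
-- and the last entry is the single remaining value.
σAux : ℕ → ℕ → Word → List ℕ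
σAux lo hi []            = lo ∷ []
σAux lo hi (false ∷ w)   = lo ∷ σAux (suc lo) hi w
σAux lo hi (true  ∷ w)   = hi ∷ σAux lo (hi ∸ 1) w

-- σ(w) is a permutation of [n] = {1,…,n}, n = |w| + 1.
σ : Word → List ℕ
σ w = σAux 1 (suc (length w)) w

runs : Word → ℕ
runs []           = 0
runs (x ∷ [])     = 1
runs (x ∷ y ∷ xs) = (if does (x ≟ᵇ y) then 0 else 1) + runs (y ∷ xs)

rotate : ℕ → List ℕ → List ℕ
rotate k xs = drop k xs ++ take k xs

OrderIso : List ℕ → List ℕ → Set
OrderIso xs ys =
  Σ (length xs ≡ length ys) λ eq →
    ∀ (i j : Fin (length xs)) →
      (lookup xs i < lookup xs j) ⇔ (lookup ys (cast eq i) < lookup ys (cast eq j))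

ContainsPattern : List ℕ → List ℕ → Set
ContainsPattern τ π = ∃ λ s → (s ⊆ τ) × OrderIso s π

-- [τ] contains [π]: some rotation of τ contains π
CircContains : List ℕ → List ℕ → Set
CircContains τ π = ∃ λ k → ContainsPattern (rotate k τ) π

zeroOne : ℕ → ℕ → Word
zeroOne a b = replicate (suc a) false ++ replicate b true

oneZero : ℕ → ℕ → Word
oneZero a b = replicate (suc b) true ++ replicate a false

{-# OPTIONS --safe #-}
module Submission where

-- Call v the shape of a sequence when every entry but the last lies below (letter 0) or
-- above (letter 1) all later entries; the sequences order-isomorphic to σ v are exactly
-- those of shape v, and the subsequences of σ w realise exactly the shapes u ⊆ w.
-- A subsequence of a rotation of σ w is s₁ s₂ with s₂ s₁ a subsequence of σ w. When both
-- parts are nonempty their heads are global extremes of opposite kinds, and this forces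
-- the shapes of s₁ s₂ and s₂ s₁ to be b^{a+1} (¬b)^c and (¬b)^{c+1} b^a. Conversely such
-- a two-block sequence can be cut after its first block and rotated into the other shape.
-- So [σ w] contains [σ v] iff v ⊆ w, or v has two runs and its partner is a subword of w.

open import Defs
open import Data.Bool using (Bool; true; false; not)
open import Data.Bool.Properties using (_≟_; not-¬)
open import Data.Nat using (ℕ; zero; suc; _+_; _≤_; _<_; z≤n; s≤s)
open import Data.Nat.Properties
  using (+-suc; ≤-refl; ≤-trans; m≤m+n; n≤1+n; m≤n⇒m≤1+n; <-asym; <-irrefl; <⇒≱; suc-injective)
open import Data.List using (List; []; _∷_; _++_; length; take; drop; replicate; lookup)
open import Data.List.Properties using (take++drop≡id; length-replicate; ++-identityʳ; ∷-injectiveˡ; ∷-injectiveʳ)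
open import Data.List.Membership.Propositional using (_∈_)
open import Data.List.Membership.Propositional.Properties using (∈-++⁺ʳ; ∈-lookup)
open import Data.List.Relation.Unary.Any using (here; index)
open import Data.List.Relation.Unary.Any.Properties using (lookup-index)
open import Data.List.Relation.Unary.All as All using (All; []; _∷_)
open import Data.List.Relation.Unary.All.Properties using (++⁻ˡ; ++⁻ʳ) renaming (++⁺ to All-++⁺)
open import Data.List.Relation.Unary.AllPairs using (AllPairs; []; _∷_)
open import Data.List.Relation.Binary.Sublist.Propositional using (_⊆_; []; _∷_; _∷ʳ_; minimum)
open import Data.List.Relation.Binary.Sublist.Propositional.Properties using (All-resp-⊆; ++⁺)
open import Data.Fin using (Fin; zero; suc; cast)
open import Data.Product using (∃; ∃₂; _×_; _,_; proj₁; proj₂; map₁; map₂)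
open import Data.Sum as Sum using (_⊎_; inj₁; inj₂; fromInj₁; swap)
open import Data.Empty using (⊥-elim)
open import Function using (_∘_)
open import Function.Bundles using (_⇔_; mk⇔; Equivalence)
import Function.Properties.Equivalence as ⇔
open import Relation.Binary.PropositionalEquality using (_≡_; _≢_; refl; sym; trans; cong; subst; subst₂)
open import Relation.Nullary using (does)

Beyond : Bool → ℕ → ℕ → Set
Beyond false x y = x < y
Beyond true  x y = y < x

Beyond-functional : ∀ b c {x y} → Beyond b x y → Beyond c x y → b ≡ c
Beyond-functional false false _ _ = refl
Beyond-functional true  true  _ _ = refl
Beyond-functional false true  p q = ⊥-elim (<-asym p q)
Beyond-functional true  false p q = ⊥-elim (<-asym p q)

Beyond-flip : ∀ b {x y} → Beyond b x y → Beyond (not b) y x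
Beyond-flip false p = p
Beyond-flip true  p = p

Beyond-flip⁻ : ∀ b {x y} → Beyond (not b) x y → Beyond b y x
Beyond-flip⁻ false p = p
Beyond-flip⁻ true  p = p

Beyond-opposite : ∀ b c {x y} → Beyond b x y → Beyond c y x → c ≡ not b
Beyond-opposite b c p q = Beyond-functional c (not b) q (Beyond-flip b p)

Beyond-same-order : ∀ b {x x′ y y′} → Beyond b x x′ → Beyond b y y′ →
                    (x < x′ ⇔ y < y′) × (x′ < x ⇔ y′ < y)
Beyond-same-order false p q = mk⇔ (λ _ → q) (λ _ → p) , mk⇔ (⊥-elim ∘ <-asym p) (⊥-elim ∘ <-asym q)
Beyond-same-order true  p q = mk⇔ (⊥-elim ∘ <-asym p) (⊥-elim ∘ <-asym q) , mk⇔ (λ _ → q) (λ _ → p)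

Beyond-transfer : ∀ b {x x′ y y′} → (x < x′ ⇔ y < y′) → (x′ < x ⇔ y′ < y) → Beyond b y y′ → Beyond b x x′
Beyond-transfer false below _ = Equivalence.from below
Beyond-transfer true  _ above = Equivalence.from above

<-irrefl-⇔ : ∀ {x y} → (x < x) ⇔ (y < y)
<-irrefl-⇔ = mk⇔ (⊥-elim ∘ <-irrefl refl) (⊥-elim ∘ <-irrefl refl)

data Shape : List ℕ → Word → Set where
  [_]  : ∀ x → Shape (x ∷ []) []
  step : ∀ {x xs v} b → All (Beyond b x) xs → Shape xs v → Shape (x ∷ xs) (b ∷ v)

shape-length : ∀ {s v} → Shape s v → length s ≡ suc (length v)
shape-length [ _ ]         = refl
shape-length (step _ _ sh) = cong suc (shape-length sh)

shape-unique : ∀ {s u v} → Shape s u → Shape s v → u ≡ v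
shape-unique [ _ ] [ _ ]           = refl
shape-unique [ _ ] (step _ _ ())
shape-unique (step _ [] ()) _
shape-unique (step b (p ∷ _) sh) (step c (q ∷ _) sh′)
  rewrite Beyond-functional b c p q = cong (c ∷_) (shape-unique sh sh′)

shape-uncons : ∀ {x y t u} → Shape (x ∷ t) u → y ∈ t →
               ∃₂ λ b u′ → u ≡ b ∷ u′ × All (Beyond b x) t × Shape t u′
shape-uncons [ _ ] ()
shape-uncons (step b a sh) _ = b , _ , refl , a , sh

shape-head : ∀ b {z y t u} → Shape (z ∷ t) u → y ∈ t → Beyond b z y →
             ∃ λ u′ → u ≡ b ∷ u′ × All (Beyond b z) t × Shape t u′
shape-head b sh y∈t p with shape-uncons sh y∈t
... | c , u′ , refl , a , sh′ with Beyond-functional c b (All.lookup a y∈t) p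
...   | refl = u′ , refl , a , sh′

lookup-All : ∀ {P : ℕ → Set} {xs} → All P xs → (i : Fin (length xs)) → P (lookup xs i)
lookup-All a i = All.lookup a (∈-lookup i)

tabulate-All : ∀ {P : ℕ → Set} {xs} → ((i : Fin (length xs)) → P (lookup xs i)) → All P xs
tabulate-All {P} f = All.tabulate (λ z∈ → subst P (sym (lookup-index z∈)) (f (index z∈)))

OrderIso-tail : ∀ {x y xs ys} → OrderIso (x ∷ xs) (y ∷ ys) → OrderIso xs ys
OrderIso-tail (eq , f) = suc-injective eq , λ i j → f (suc i) (suc j)

OrderIso-head : ∀ b {x y xs ys} → OrderIso (x ∷ xs) (y ∷ ys) → All (Beyond b y) ys → All (Beyond b x) xs
OrderIso-head b (eq , f) a =
  tabulate-All (λ i → Beyond-transfer b (f zero (suc i)) (f (suc i) zero) (lookup-All a _))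

OrderIso-shape : ∀ {s t v} → OrderIso s t → Shape t v → Shape s v
OrderIso-shape {x ∷ []}    _        [ _ ] = [ x ]
OrderIso-shape {[]}        (() , _) [ _ ]
OrderIso-shape {_ ∷ _ ∷ _} (() , _) [ _ ]
OrderIso-shape {[]}        (() , _) (step _ _ _)
OrderIso-shape {_ ∷ _}     iso      (step b a sh) =
  step b (OrderIso-head b iso a) (OrderIso-shape (OrderIso-tail iso) sh)

shapes-OrderIso : ∀ {s t v} → Shape s v → Shape t v → OrderIso s t
shapes-OrderIso [ _ ] [ _ ] = refl , λ { zero zero → <-irrefl-⇔ }
shapes-OrderIso {x ∷ xs} {y ∷ ys} (step b a sh) (step .b a′ sh′) with shapes-OrderIso sh sh′
... | eq , f = cong suc eq , compare
  where
  compare : ∀ i j → (lookup (x ∷ xs) i < lookup (x ∷ xs) j) ⇔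
                    (lookup (y ∷ ys) (cast (cong suc eq) i) < lookup (y ∷ ys) (cast (cong suc eq) j))
  compare zero    zero    = <-irrefl-⇔
  compare zero    (suc j) = proj₁ (Beyond-same-order b (lookup-All a j) (lookup-All a′ (cast eq j)))
  compare (suc i) zero    = proj₂ (Beyond-same-order b (lookup-All a i) (lookup-All a′ (cast eq i)))
  compare (suc i) (suc j) = f i j

σAux-range : ∀ lo w → All (λ x → lo ≤ x × x ≤ lo + length w) (σAux lo (lo + length w) w)
σAux-range lo [] = (≤-refl , m≤m+n lo 0) ∷ []
σAux-range lo (false ∷ w) rewrite +-suc lo (length w) =
  (≤-refl , m≤n⇒m≤1+n (m≤m+n lo _)) ∷ All.map (map₁ (≤-trans (n≤1+n lo))) (σAux-range (suc lo) w)
σAux-range lo (true ∷ w) rewrite +-suc lo (length w) =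
  (m≤n⇒m≤1+n (m≤m+n lo _) , ≤-refl) ∷ All.map (map₂ m≤n⇒m≤1+n) (σAux-range lo w)

σAux-shape : ∀ lo w → Shape (σAux lo (lo + length w) w) w
σAux-shape lo [] = [ lo ]
σAux-shape lo (false ∷ w) rewrite +-suc lo (length w) =
  step false (All.map proj₁ (σAux-range (suc lo) w)) (σAux-shape (suc lo) w)
σAux-shape lo (true ∷ w) rewrite +-suc lo (length w) =
  step true (All.map (s≤s ∘ proj₂) (σAux-range lo w)) (σAux-shape lo w)

σ-shape : ∀ w → Shape (σ w) w
σ-shape = σAux-shape 1

sublist-shape : ∀ {z zs t w} → z ∷ zs ⊆ t → Shape t w → ∃ λ u → u ⊆ w × Shape (z ∷ zs) u
sublist-shape (_ ∷ʳ ()) [ _ ]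
sublist-shape (refl ∷ []) [ x ] = [] , [] , [ x ]
sublist-shape (_ ∷ʳ sub) (step b _ sh) with sublist-shape sub sh
... | u , u⊆w , shu = u , b ∷ʳ u⊆w , shu
sublist-shape {z} {[]} (refl ∷ _) (step _ _ _) = [] , minimum _ , [ z ]
sublist-shape {zs = _ ∷ _} (refl ∷ sub) (step b a sh) with sublist-shape sub sh
... | u , u⊆w , shu = b ∷ u , refl ∷ u⊆w , step b (All-resp-⊆ sub a) shu

subword-shape : ∀ {t v w} → v ⊆ w → Shape t w → ∃ λ s → s ⊆ t × Shape s v
subword-shape [] [ x ] = x ∷ [] , refl ∷ [] , [ x ]
subword-shape (_ ∷ʳ v⊆w) (step {x} _ _ sh) with subword-shape v⊆w sh
... | s , s⊆t , shs = s , x ∷ʳ s⊆t , shs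
subword-shape (refl ∷ v⊆w) (step {x} b a sh) with subword-shape v⊆w sh
... | s , s⊆t , shs = x ∷ s , refl ∷ s⊆t , step b (All-resp-⊆ s⊆t a) shs

shape-sublist-⊆ : ∀ {s t v w} → s ⊆ t → Shape s v → Shape t w → v ⊆ w
shape-sublist-⊆ {_ ∷ _} {w = w} sub sh sht with sublist-shape sub sht
... | u , u⊆w , shu = subst (_⊆ w) (shape-unique shu sh) u⊆w

AllPairs⇒shape-replicate : ∀ b {x r} → AllPairs (Beyond b) (x ∷ r) → Shape (x ∷ r) (replicate (length r) b)
AllPairs⇒shape-replicate b {x} {[]}    _        = [ x ]
AllPairs⇒shape-replicate b {r = _ ∷ _} (a ∷ ap) = step b a (AllPairs⇒shape-replicate b ap)

shape-replicate⇒AllPairs : ∀ b n {s} → Shape s (replicate n b) → AllPairs (Beyond b) s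
shape-replicate⇒AllPairs b zero    [ _ ]          = [] ∷ []
shape-replicate⇒AllPairs b (suc n) (step .b a sh) = a ∷ shape-replicate⇒AllPairs b n sh

shape-++-beyond : ∀ b zs {ys y u} → Shape (zs ++ ys) u → y ∈ ys → All (λ z → Beyond b z y) zs →
                  ∃ λ u′ → u ≡ replicate (length zs) b ++ u′ × AllPairs (Beyond b) zs × Shape ys u′
shape-++-beyond b []       sh _    []       = _ , refl , [] , sh
shape-++-beyond b (z ∷ zs) sh y∈ys (p ∷ ps) with shape-head b sh (∈-++⁺ʳ zs y∈ys) p
... | _ , refl , a , sh′ with shape-++-beyond b zs sh′ y∈ys ps
...   | u′ , refl , ap , shys = u′ , refl , ++⁻ˡ zs a ∷ ap , shys

shape-replicate-++⁻ : ∀ m b {s v} → Shape s (replicate m b ++ v) →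
  ∃₂ λ ps r → s ≡ ps ++ r × length ps ≡ m × AllPairs (Beyond b) ps ×
              All (λ p → All (Beyond b p) r) ps × Shape r v
shape-replicate-++⁻ zero    b sh = [] , _ , refl , refl , [] , [] , sh
shape-replicate-++⁻ (suc m) b (step {x} .b a sh) with shape-replicate-++⁻ m b sh
... | ps , r , refl , refl , ap , across , shr =
  x ∷ ps , r , refl , refl , ++⁻ˡ ps a ∷ ap , ++⁻ʳ ps a ∷ across , shr

shape-replicate-++⁺ : ∀ b {ps r v} → AllPairs (Beyond b) ps → All (λ p → All (Beyond b p) r) ps →
                      Shape r v → Shape (ps ++ r) (replicate (length ps) b ++ v)
shape-replicate-++⁺ b []       []            sh = sh
shape-replicate-++⁺ b (a ∷ ap) (a′ ∷ across) sh = step b (All-++⁺ a a′) (shape-replicate-++⁺ b ap across sh)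

All-transpose : ∀ {R : ℕ → ℕ → Set} {ps qs} → All (λ p → All (R p) qs) ps → All (λ q → All (λ p → R p q) ps) qs
All-transpose {qs = []}    _ = []
All-transpose {qs = _ ∷ _} a = All.map All.head a ∷ All-transpose (All.map All.tail a)

-- For b = 0 the pair 0^{a+1} 1^c, 1^{c+1} 0^a of the theorem.
data Partners : Word → Word → Set where
  partners : ∀ b a c → Partners (replicate (suc a) b ++ replicate c (not b))
                                (replicate (suc c) (not b) ++ replicate a b)

Partners-sym : ∀ {v u} → Partners v u → Partners u v
Partners-sym (partners false a c) = partners true  c a
Partners-sym (partners true  a c) = partners false c a

rotation-shape : ∀ b c {x xs y ys v u} → Shape (x ∷ xs ++ y ∷ ys) v → Shape (y ∷ ys ++ x ∷ xs) u →
                 All (λ z → Beyond b z y) (x ∷ xs) → All (λ z → Beyond c z x) (y ∷ ys) →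
                 v ≡ replicate (suc (length xs)) b ++ replicate (length ys) c
rotation-shape b c {x} {xs} {y} {ys} shA shB beyond-y beyond-x
  with shape-++-beyond b (x ∷ xs) shA (here refl) beyond-y | shape-++-beyond c (y ∷ ys) shB (here refl) beyond-x
... | _ , refl , _ , shy | _ , _ , ap , _ =
  cong (replicate (suc (length xs)) b ++_) (shape-unique shy (AllPairs⇒shape-replicate c ap))

rotation-partners : ∀ {x xs y ys v u} → Shape (x ∷ xs ++ y ∷ ys) v → Shape (y ∷ ys ++ x ∷ xs) u → Partners v u
rotation-partners {x} {xs} {y} {ys} shA shB
  with shape-uncons shA (∈-++⁺ʳ xs (here refl)) | shape-uncons shB (∈-++⁺ʳ ys (here refl))
... | b , _ , _ , x-beyond , _ | c , _ , _ , y-beyond , _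
  with Beyond-opposite b c (All.head (++⁻ʳ xs x-beyond)) (All.head (++⁻ʳ ys y-beyond))
... | refl = subst₂ Partners (sym (rotation-shape b (not b) shA shB beyond-y beyond-x))
                            (sym (rotation-shape (not b) b shB shA beyond-x beyond-y))
                            (partners b (length xs) (length ys))
  where
  beyond-y : All (λ z → Beyond b z y) (x ∷ xs)
  beyond-y = All.map (Beyond-flip⁻ b) (++⁻ʳ ys y-beyond)
  beyond-x : All (λ z → Beyond (not b) z x) (y ∷ ys)
  beyond-x = All.map (Beyond-flip b) (++⁻ʳ xs x-beyond)

partner-rotation : ∀ {v u s} → Partners v u → Shape s v → ∃₂ λ s₁ s₂ → s ≡ s₁ ++ s₂ × Shape (s₂ ++ s₁) u
partner-rotation (partners b m n) sh with shape-replicate-++⁻ (suc m) b sh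
... | p ∷ ps , r , refl , refl , ap , across , shr =
  p ∷ ps , r , refl ,
  subst (λ k → Shape (r ++ p ∷ ps) (replicate k (not b) ++ replicate (length ps) b)) length-r
        (shape-replicate-++⁺ (not b) (shape-replicate⇒AllPairs (not b) n shr)
                             (All.map (All.map (Beyond-flip b)) (All-transpose across))
                             (AllPairs⇒shape-replicate b ap))
  where
  length-r : length r ≡ suc n
  length-r = trans (shape-length shr) (cong suc (length-replicate n))

⊆-++-split : ∀ {A : Set} (xs : List A) {ys s} → s ⊆ xs ++ ys →
             ∃₂ λ s₁ s₂ → s ≡ s₁ ++ s₂ × s₁ ⊆ xs × s₂ ⊆ ys
⊆-++-split []       sub          = [] , _ , refl , [] , sub
⊆-++-split (x ∷ xs) (_ ∷ʳ sub)   with ⊆-++-split xs sub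
... | s₁ , s₂ , refl , p₁ , p₂ = s₁ , s₂ , refl , x ∷ʳ p₁ , p₂
⊆-++-split (x ∷ xs) (refl ∷ sub) with ⊆-++-split xs sub
... | s₁ , s₂ , refl , p₁ , p₂ = x ∷ s₁ , s₂ , refl , refl ∷ p₁ , p₂

++-⊆-take-drop : ∀ {A : Set} (xs : List A) {ys τ} → xs ++ ys ⊆ τ → ∃ λ k → xs ⊆ take k τ × ys ⊆ drop k τ
++-⊆-take-drop []       sub          = 0 , [] , sub
++-⊆-take-drop (x ∷ xs) (y ∷ʳ sub)   with ++-⊆-take-drop (x ∷ xs) sub
... | k , p₁ , p₂ = suc k , y ∷ʳ p₁ , p₂
++-⊆-take-drop (x ∷ xs) (refl ∷ sub) with ++-⊆-take-drop xs sub
... | k , p₁ , p₂ = suc k , refl ∷ p₁ , p₂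

⊆-rotate⁻ : ∀ k {τ s} → s ⊆ rotate k τ → ∃₂ λ s₁ s₂ → s ≡ s₁ ++ s₂ × s₂ ++ s₁ ⊆ τ
⊆-rotate⁻ k {τ} sub with ⊆-++-split (drop k τ) sub
... | s₁ , s₂ , refl , p₁ , p₂ = s₁ , s₂ , refl , subst (s₂ ++ s₁ ⊆_) (take++drop≡id k τ) (++⁺ p₂ p₁)

⊆-rotate⁺ : ∀ s₁ {s₂ τ} → s₁ ++ s₂ ⊆ τ → ∃ λ k → s₂ ++ s₁ ⊆ rotate k τ
⊆-rotate⁺ s₁ sub with ++-⊆-take-drop s₁ sub
... | k , p₁ , p₂ = k , ++⁺ p₂ p₁

rotation-subsequence-shape : ∀ k {s τ v w} → s ⊆ rotate k τ → Shape s v → Shape τ w →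
                             v ⊆ w ⊎ ∃ λ u → Partners v u × u ⊆ w
rotation-subsequence-shape k sub sh shτ with ⊆-rotate⁻ k sub
... | [] , s₂ , refl , sub′ = inj₁ (shape-sublist-⊆ (subst (_⊆ _) (++-identityʳ s₂) sub′) sh shτ)
... | s₁ , [] , refl , sub′ = inj₁ (shape-sublist-⊆ sub′ (subst (λ t → Shape t _) (++-identityʳ s₁) sh) shτ)
... | _ ∷ _ , _ ∷ _ , refl , sub′ with sublist-shape sub′ shτ
...   | u , u⊆w , shu = inj₂ (u , rotation-partners sh shu , u⊆w)

circContains-σ : ∀ w v → CircContains (σ w) (σ v) ⇔ (v ⊆ w ⊎ ∃ λ u → Partners v u × u ⊆ w)
circContains-σ w v = mk⇔ to from
  where
  realise : ∀ k {s} → s ⊆ rotate k (σ w) → Shape s v → CircContains (σ w) (σ v)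
  realise k {s} sub sh = k , s , sub , shapes-OrderIso sh (σ-shape v)

  to : CircContains (σ w) (σ v) → v ⊆ w ⊎ ∃ λ u → Partners v u × u ⊆ w
  to (k , _ , sub , iso) = rotation-subsequence-shape k sub (OrderIso-shape iso (σ-shape v)) (σ-shape w)

  from : (v ⊆ w ⊎ ∃ λ u → Partners v u × u ⊆ w) → CircContains (σ w) (σ v)
  from (inj₁ v⊆w) with subword-shape v⊆w (σ-shape w)
  ... | s , sub , sh = realise 0 (subst (s ⊆_) (sym (++-identityʳ (σ w))) sub) sh
  from (inj₂ (u , p , u⊆w)) with subword-shape u⊆w (σ-shape w)
  ... | _ , sub , shu with partner-rotation (Partners-sym p) shu
  ...   | s₁ , s₂ , refl , sh with ⊆-rotate⁺ s₁ sub
  ...     | k , sub′ = realise k sub′ sh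

runs-∷ : ∀ x r → runs (x ∷ r) ≤ suc (runs r)
runs-∷ x []      = ≤-refl
runs-∷ x (y ∷ r) with does (x ≟ y)
... | true  = n≤1+n _
... | false = ≤-refl

runs-replicate-++ : ∀ n x r → runs (replicate (suc n) x ++ r) ≤ suc (runs r)
runs-replicate-++ zero    x     r = runs-∷ x r
runs-replicate-++ (suc n) false r = runs-replicate-++ n false r
runs-replicate-++ (suc n) true  r = runs-replicate-++ n true r

runs-replicate : ∀ n x → runs (replicate n x) ≤ 1
runs-replicate zero          _     = z≤n
runs-replicate (suc zero)    _     = ≤-refl
runs-replicate (suc (suc n)) false = runs-replicate (suc n) false
runs-replicate (suc (suc n)) true  = runs-replicate (suc n) true

Partners-runs : ∀ {v u} → Partners v u → runs v ≤ 2
Partners-runs (partners b a c) = ≤-trans (runs-replicate-++ a b _) (s≤s (runs-replicate c (not b)))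

replicate-injective : ∀ {x : Bool} m n → replicate m x ≡ replicate n x → m ≡ n
replicate-injective m n e = trans (sym (length-replicate m)) (trans (cong length e) (length-replicate n))

two-blocks-injective : ∀ {x y : Bool} → x ≢ y → ∀ a c a′ c′ →
                       replicate a x ++ replicate c y ≡ replicate a′ x ++ replicate c′ y → a ≡ a′ × c ≡ c′
two-blocks-injective x≢y zero    c       zero     c′       e = refl , replicate-injective c c′ e
two-blocks-injective x≢y (suc a) c       (suc a′) c′       e =
  map₁ (cong suc) (two-blocks-injective x≢y a c a′ c′ (∷-injectiveʳ e))
two-blocks-injective x≢y zero    (suc c) (suc a′) c′       e = ⊥-elim (x≢y (sym (∷-injectiveˡ e)))
two-blocks-injective x≢y (suc a) c       zero     (suc c′) e = ⊥-elim (x≢y (∷-injectiveˡ e))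
two-blocks-injective _   zero    zero    (suc _)  _        ()
two-blocks-injective _   (suc _) _       zero     zero     ()

partner-unique : ∀ {v u u′} → Partners v u → Partners v u′ → u ≡ u′
partner-unique p q = unique p q refl
  where
  unique : ∀ {v v′ u u′} → Partners v u → Partners v′ u′ → v ≡ v′ → u ≡ u′
  unique (partners b a c) (partners b′ a′ c′) e with ∷-injectiveˡ e
  ... | refl with two-blocks-injective (not-¬ refl) (suc a) c (suc a′) c′ e
  ...   | refl , refl = refl

circContains-σ-partner : ∀ w {v u} → Partners v u → CircContains (σ w) (σ v) ⇔ (v ⊆ w ⊎ u ⊆ w)
circContains-σ-partner w {v} {u} p = ⇔.trans (circContains-σ w v) (mk⇔ (Sum.map₂ to) (Sum.map₂ from))
  where
  to : (∃ λ u′ → Partners v u′ × u′ ⊆ w) → u ⊆ w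
  to (_ , q , u′⊆w) = subst (_⊆ w) (partner-unique q p) u′⊆w

  from : u ⊆ w → ∃ λ u′ → Partners v u′ × u′ ⊆ w
  from u⊆w = u , p , u⊆w

circContains-σ-many-runs : ∀ w v → 2 < runs v → CircContains (σ w) (σ v) ⇔ (v ⊆ w)
circContains-σ-many-runs w v 2<runs = ⇔.trans (circContains-σ w v) (mk⇔ (fromInj₁ two-runs) inj₁)
  where
  two-runs : (∃ λ u → Partners v u × u ⊆ w) → v ⊆ w
  two-runs (_ , p , _) = ⊥-elim (<⇒≱ 2<runs (Partners-runs p))

theorem3p9 :
    ((w w' : Word) → 2 < runs w' →
      (CircContains (σ w) (σ w') ⇔ (w' ⊆ w)))
    × ((w : Word) (a b : ℕ) →
      (CircContains (σ w) (σ (zeroOne a b)) ⇔ ((zeroOne a b ⊆ w) ⊎ (oneZero a b ⊆ w))))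
    × ((w : Word) (a b : ℕ) →
      (CircContains (σ w) (σ (oneZero a b)) ⇔ ((zeroOne a b ⊆ w) ⊎ (oneZero a b ⊆ w))))
theorem3p9 =
    circContains-σ-many-runs
  , (λ w a b → circContains-σ-partner w (partners false a b))
  , (λ w a b → ⇔.trans (circContains-σ-partner w (partners true b a)) (mk⇔ swap swap))
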